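{- Let $k$ be a positive integer. Let $G_0,G_1,\dots,G_k$ be induced subgraphs of a graph $G$ such that $G=G_0\cup G_1\cup\dots\cup G_k$, $|V(G_0)\cap V(G_i)|=2$ for every $1\le i\le k$, and $V(G_i)\cap V(G_j)\subseteq V(G_0)$ for all distinct $i,j\in\{1,\dots,k\}$. For $1\le i\le k$ write $V(G_0)\cap V(G_i)=\{u_i,v_i\}$, and assume that $u_iv_i$ is not an edge of $G_i$. Let $a,b,c,d$ be positive integers with $a/b\ge c/d$. If $G_0$ has an $(a:b)$-coloring, and for every $1\le i\le k$ both $G_i+u_iv_i$ and $G_i/u_iv_i$ have $(c:d)$-colorings, then $G$ has an $(ad:bd)$-coloring.
   Context: An $(a:b)$-coloring assigns to each vertex a $b$-subset of $\{1,\dots,a\}$ so that adjacent vertices receive disjoint sets. $G_i+u_iv_i$ is the graph obtained from $G_i$ by adding the edge $u_iv_i$; $G_i/u_iv_i$ is the graph obtained from $G_i$ by identifying $u_i$ and $v_i$ and deleting resulting loops and parallel edges. -}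

module Defs where

open import Data.Nat using (ℕ)
open import Data.Fin using (Fin)
open import Data.Fin.Subset using (Subset; _∈_; _∩_; ∣_∣; Empty)
open import Data.Product using (Σ; _×_; proj₁)
open import Data.Sum using (_⊎_)
open import Relation.Nullary using (¬_)
open import Relation.Binary.PropositionalEquality using (_≡_; _≢_)

record Graph : Set₁ where
  field
    V   : Set
    Adj : V → V → Set
open Graph public

record SimpleGraph (n : ℕ) : Set₁ where
  field
    adj   : Fin n → Fin n → Set
    sym   : ∀ {x y} → adj x y → adj y x
    irrfl : ∀ {x} → ¬ adj x x
open SimpleGraph public

module _ {n : ℕ} (G : SimpleGraph n) where

  whole : Graph
  whole = record { V = Fin n ; Adj = adj G }

  induced : Subset n → Graph
  induced S = record { V = Σ (Fin n) (λ x → x ∈ S)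
                     ; Adj = λ x y → adj G (proj₁ x) (proj₁ y) }

  plusEdge : Subset n → Fin n → Fin n → Graph
  plusEdge S u v = record
    { V = Σ (Fin n) (λ x → x ∈ S)
    ; Adj = λ x y → adj G (proj₁ x) (proj₁ y)
                    ⊎ ((proj₁ x ≡ u × proj₁ y ≡ v) ⊎ (proj₁ x ≡ v × proj₁ y ≡ u)) }

  -- G[S] / uv : identify v into u (the merged vertex is represented by u),
  -- deleting loops; parallel edges collapse automatically.
  contract : Subset n → Fin n → Fin n → Graph
  contract S u v = record
    { V = Σ (Fin n) (λ x → x ∈ S × x ≢ v)
    ; Adj = λ x y → proj₁ x ≢ proj₁ y ×
                    (adj G (proj₁ x) (proj₁ y)
                     ⊎ ((proj₁ x ≡ u × adj G v (proj₁ y))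
                     ⊎ (proj₁ y ≡ u × adj G (proj₁ x) v))) }

HasColoring : ℕ → ℕ → Graph → Set
HasColoring a b H =
  Σ (V H → Subset a) λ f →
    (∀ x → ∣ f x ∣ ≡ b) × (∀ x y → Adj H x y → Empty (f x ∩ f y))

module Submission where

open import Defs hiding (sym)
open import Data.Nat using (ℕ; _≤_; _*_)
open import Data.Fin using (Fin)
open import Data.Fin.Subset using (Subset; _∈_; _∩_; _∪_; _⊆_; ⁅_⁆; ∣_∣)
open import Data.Product using (Σ; _×_)
open import Data.Sum using (_⊎_)
open import Relation.Nullary using (¬_)
open import Relation.Binary.PropositionalEquality using (_≡_; _≢_)

open import Data.Nat using (zero; suc; _+_; _∸_; z≤n; s≤s)
open import Data.Nat.Properties
  using (+-cancelˡ-≡; +-assoc; +-identityʳ; *-zeroʳ; *-comm; *-distribʳ-+; m+[n∸m]≡n;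
         ≤-trans; ≤-reflexive; +-0-commutativeMonoid; +-commutativeSemigroup)
open import Data.Bool using (Bool; true; false; not; _∧_; if_then_else_)
import Data.Bool.Properties as Bool
open import Data.Fin using (zero; suc; punchIn; _≟_)
open import Data.Fin.Subset using (⊥; ∁; Empty)
open import Data.Fin.Subset.Properties
  using (_∈?_; Empty-unique; ∉⊥; ∣⊥∣≡0; ∣⊤∣≡n; ∣p∣≤n; ∣∁p∣≡n∸∣p∣; ∣p∩q∣≤∣p∣; ∩-idem; ∪-idem;
         x∈p∩q⁺; x∈p∩q⁻; x∈p∪q⁺; x∈p∪q⁻; x∈⁅x⁆; x∈⁅y⁆⇒x≡y; ∣⁅x⁆∣≡1)
open import Data.Fin.Permutation using (Permutation; insert; insert-punchIn; _⟨$⟩ʳ_)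
import Data.Fin.Permutation as Perm
open import Data.Product using (Σ-syntax; ∃; _,_; proj₁; proj₂)
open import Data.Product.Properties using (≡-dec)
open import Data.Sum using (inj₁; inj₂)
open import Data.Empty using (⊥-elim)
open import Data.Vec using ([]; _∷_; _++_; lookup; tabulate; replicate)
open import Data.Vec.Properties
  using (tabulate-cong; tabulate∘lookup; lookup∘tabulate; lookup-zipWith; lookup-replicate;
         zipWith-++; zipWith-replicate)
open import Function using (_∘_; id)
open import Relation.Nullary using (yes; no; does; ¬?)
open import Relation.Nullary.Decidable using (_×-dec_)
open import Relation.Unary using (Decidable)
open import Relation.Binary.Definitions using (DecidableEquality)
open import Relation.Binary.PropositionalEquality
  using (refl; sym; trans; cong; cong₂; subst; module ≡-Reasoning)
open import Algebra.Properties.CommutativeSemigroup +-commutativeSemigroup using (x∙yz≈y∙xz)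
import Algebra.Properties.CommutativeMonoid.Sum as Sum
open Sum +-0-commutativeMonoid using (sum; sum-cong-≗; sum-remove; sum-permute; ∑-distrib-+)
open ≡-Reasoning

-- Blowing every color of an (a:b)-coloring φ of G₀ up into d copies gives an
-- (ad:bd)-coloring of G₀ in which u_i and v_i receive bd-sets meeting in t·d
-- colors, t = |φ(u_i) ∩ φ(v_i)| ≤ b.  For the part G_i, take b blocks of c
-- colors: t blocks are colored by the (c:d)-coloring of G_i/u_iv_i (which
-- gives u_i, v_i the same set) and the other b − t blocks by that of
-- G_i+u_iv_i (which gives them disjoint sets); padded to a·d ≥ b·c colors,
-- this is an (ad:bd)-coloring of G_i whose terminal sets again have sizes bd,
-- bd and meet in t·d colors.  Two pairs of sets with the same three sizes
-- differ by a permutation of the palette, so after permuting, the coloring of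
-- G_i agrees with that of G₀ at u_i and v_i.  Since different parts meet only
-- inside G₀, all these colorings glue to an (ad:bd)-coloring of G.

-- Counting the points of Fin N at which a Boolean predicate holds, as a sum
-- in the additive monoid of ℕ (so the library's lemmas on sums apply).

bit : Bool → ℕ
bit true  = 1
bit false = 0

count : ∀ {N} → (Fin N → Bool) → ℕ
count p = sum (bit ∘ p)

count-true : ∀ N → count {N} (λ _ → true) ≡ N
count-true zero    = refl
count-true (suc N) = cong suc (count-true N)

count-witness : ∀ {N} (p : Fin N → Bool) → count p ≢ 0 → ∃ λ x → p x ≡ true
count-witness {zero}  p nonzero = ⊥-elim (nonzero refl)
count-witness {suc N} p nonzero with p zero in p0
... | true  = zero , p0
... | false with x , px ← count-witness (p ∘ suc) nonzero = suc x , px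

count-remove : ∀ {N} (p : Fin (suc N) → Bool) x → count p ≡ bit (p x) + count (p ∘ punchIn x)
count-remove p x = sum-remove {i = x} (bit ∘ p)

count-permute : ∀ {N} (p : Fin N → Bool) (π : Permutation N N) →
                count (p ∘ (π ⟨$⟩ʳ_)) ≡ count p
count-permute p π = sym (sum-permute (bit ∘ p) π)

count-additive : ∀ {N} {p q r : Fin N → Bool} → (∀ z → bit (p z) ≡ bit (q z) + bit (r z)) →
                 count p ≡ count q + count r
count-additive {q = q} {r} split = trans (sum-cong-≗ split) (∑-distrib-+ (bit ∘ q) (bit ∘ r))

∣p∣≡count : ∀ {N} (p : Subset N) → ∣ p ∣ ≡ count (lookup p)
∣p∣≡count []          = refl
∣p∣≡count (true ∷ p)  = cong suc (∣p∣≡count p)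
∣p∣≡count (false ∷ p) = ∣p∣≡count p

-- By induction on N: the label of 0
-- under g occurs somewhere under f, at x say; match 0 with x and recurse on
-- the remaining points.

module Relabel {A : Set} (_≟ᴬ_ : DecidableEquality A) where

  fibre : ∀ {N} → (Fin N → A) → A → ℕ
  fibre f α = count (λ z → does (f z ≟ᴬ α))

  relabel : ∀ {N} (f g : Fin N → A) → (∀ α → fibre f α ≡ fibre g α) →
            Σ[ π ∈ Permutation N N ] (∀ z → f (π ⟨$⟩ʳ z) ≡ g z)
  relabel {zero}  f g same = Perm.id , λ ()
  relabel {suc N} f g same = insert zero x π , agree
    where
    g0-occurs : fibre g (g zero) ≢ 0
    g0-occurs with g zero ≟ᴬ g zero
    ... | yes _ = λ ()
    ... | no ne = ⊥-elim (ne refl)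

    preimage : ∃ λ x → does (f x ≟ᴬ g zero) ≡ true
    preimage = count-witness _ λ eq → g0-occurs (trans (sym (same (g zero))) eq)

    x : Fin (suc N)
    x = proj₁ preimage

    fx≡g0 : f x ≡ g zero
    fx≡g0 with f x ≟ᴬ g zero | proj₂ preimage
    ... | yes eq | _ = eq

    -- removing x from f and 0 from g removes the same label from both
    same′ : ∀ α → fibre (f ∘ punchIn x) α ≡ fibre (g ∘ suc) α
    same′ α = +-cancelˡ-≡ (bit (does (g zero ≟ᴬ α))) _ _ (begin
      bit (does (g zero ≟ᴬ α)) + fibre (f ∘ punchIn x) α
        ≡⟨ cong (λ β → bit (does (β ≟ᴬ α)) + fibre (f ∘ punchIn x) α) fx≡g0 ⟨
      bit (does (f x ≟ᴬ α)) + fibre (f ∘ punchIn x) α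
        ≡⟨ count-remove (λ z → does (f z ≟ᴬ α)) x ⟨
      fibre f α
        ≡⟨ same α ⟩
      fibre g α ∎)

    rest : Σ[ π ∈ Permutation N N ] (∀ z → f (punchIn x (π ⟨$⟩ʳ z)) ≡ g (suc z))
    rest = relabel (f ∘ punchIn x) (g ∘ suc) same′

    π : Permutation N N
    π = proj₁ rest

    agree : ∀ z → f (insert zero x π ⟨$⟩ʳ z) ≡ g z
    agree zero    = fx≡g0
    agree (suc z) = trans (cong f (insert-punchIn zero x π z)) (proj₂ rest z)

-- Pairs of subsets.  A pair (p₁, p₂) of subsets of Fin N labels every point
-- by its membership pattern in Bool × Bool; the four fibre sizes are
-- determined by N, ∣p₁∣, ∣p₂∣ and ∣p₁ ∩ p₂∣.

_≟₂_ : DecidableEquality (Bool × Bool)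
_≟₂_ = ≡-dec Bool._≟_ Bool._≟_

open Relabel _≟₂_ using (fibre; relabel)

is : Bool × Bool → Bool × Bool → Bool
is β α = does (β ≟₂ α)

class-both : ∀ β₁ β₂ → bit (β₁ ∧ β₂) ≡ bit (is (β₁ , β₂) (true , true))
class-both true  true  = refl
class-both true  false = refl
class-both false true  = refl
class-both false false = refl

class-first : ∀ β₁ β₂ → bit β₁ ≡ bit (is (β₁ , β₂) (true , true)) + bit (is (β₁ , β₂) (true , false))
class-first true  true  = refl
class-first true  false = refl
class-first false true  = refl
class-first false false = refl

class-second : ∀ β₁ β₂ → bit β₂ ≡ bit (is (β₁ , β₂) (true , true)) + bit (is (β₁ , β₂) (false , true))
class-second true  true  = refl
class-second true  false = refl
class-second false true  = refl
class-second false false = refl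

class-outside : ∀ β₁ β₂ →
                bit (not β₁) ≡ bit (is (β₁ , β₂) (false , true)) + bit (is (β₁ , β₂) (false , false))
class-outside true  true  = refl
class-outside true  false = refl
class-outside false true  = refl
class-outside false false = refl

class-total : ∀ β → bit true ≡ bit β + bit (not β)
class-total true  = refl
class-total false = refl

module PairFibres {N} (p₁ p₂ : Subset N) where

  label : Fin N → Bool × Bool
  label z = lookup p₁ z , lookup p₂ z

  fibre-tt : ∣ p₁ ∩ p₂ ∣ ≡ fibre label (true , true)
  fibre-tt = trans (∣p∣≡count (p₁ ∩ p₂)) (sum-cong-≗ λ z →
    trans (cong bit (lookup-zipWith _∧_ z p₁ p₂)) (class-both (lookup p₁ z) (lookup p₂ z)))

  fibre-t· : ∣ p₁ ∣ ≡ fibre label (true , true) + fibre label (true , false)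
  fibre-t· = trans (∣p∣≡count p₁) (count-additive λ z → class-first (lookup p₁ z) (lookup p₂ z))

  fibre-·t : ∣ p₂ ∣ ≡ fibre label (true , true) + fibre label (false , true)
  fibre-·t = trans (∣p∣≡count p₂) (count-additive λ z → class-second (lookup p₁ z) (lookup p₂ z))

  fibre-f· : N ≡ ∣ p₁ ∣ + (fibre label (false , true) + fibre label (false , false))
  fibre-f· = begin
    N                                           ≡⟨ count-true N ⟨
    count {N} (λ _ → true)                      ≡⟨ count-additive (class-total ∘ lookup p₁) ⟩
    count (lookup p₁) + count (not ∘ lookup p₁)
      ≡⟨ cong₂ _+_ (sym (∣p∣≡count p₁))
                   (count-additive λ z → class-outside (lookup p₁ z) (lookup p₂ z)) ⟩
    ∣ p₁ ∣ + (fibre label (false , true) + fibre label (false , false)) ∎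

permute : ∀ {N} → Permutation N N → Subset N → Subset N
permute π p = tabulate (lookup p ∘ (π ⟨$⟩ʳ_))

permute-onto : ∀ {N} (π : Permutation N N) {p q : Subset N} →
               (∀ z → lookup p (π ⟨$⟩ʳ z) ≡ lookup q z) → permute π p ≡ q
permute-onto π {q = q} carries = trans (tabulate-cong carries) (tabulate∘lookup q)

cancel : ∀ {a a′ x y} → a ≡ a′ → a + x ≡ a′ + y → x ≡ y
cancel {a} refl = +-cancelˡ-≡ a _ _

match : ∀ {N} (p₁ p₂ q₁ q₂ : Subset N) →
        ∣ p₁ ∣ ≡ ∣ q₁ ∣ → ∣ p₂ ∣ ≡ ∣ q₂ ∣ → ∣ p₁ ∩ p₂ ∣ ≡ ∣ q₁ ∩ q₂ ∣ →
        Σ[ π ∈ Permutation N N ] (permute π p₁ ≡ q₁ × permute π p₂ ≡ q₂)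
match {N} p₁ p₂ q₁ q₂ size₁ size₂ size₁₂ =
  π , permute-onto π {p₁} (cong proj₁ ∘ carried) , permute-onto π {p₂} (cong proj₂ ∘ carried)
  where
  module P = PairFibres p₁ p₂
  module Q = PairFibres q₁ q₂

  both : fibre P.label (true , true) ≡ fibre Q.label (true , true)
  both = trans (sym P.fibre-tt) (trans size₁₂ Q.fibre-tt)

  second-only : fibre P.label (false , true) ≡ fibre Q.label (false , true)
  second-only = cancel both (trans (sym P.fibre-·t) (trans size₂ Q.fibre-·t))

  same : ∀ α → fibre P.label α ≡ fibre Q.label α
  same (true  , true)  = both
  same (true  , false) = cancel both (trans (sym P.fibre-t·) (trans size₁ Q.fibre-t·))
  same (false , true)  = second-only
  same (false , false) = cancel second-only (cancel size₁ (trans (sym P.fibre-f·) Q.fibre-f·))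

  relabelled : Σ[ π ∈ Permutation N N ] (∀ z → P.label (π ⟨$⟩ʳ z) ≡ Q.label z)
  relabelled = relabel P.label Q.label same

  π : Permutation N N
  π = proj₁ relabelled

  carried : ∀ z → P.label (π ⟨$⟩ʳ z) ≡ Q.label z
  carried = proj₂ relabelled

⊥-Empty : ∀ {N} {p : Subset N} → p ≡ ⊥ → Empty p
⊥-Empty refl (_ , x∈⊥) = ∉⊥ x∈⊥

⊥++⊥ : ∀ m {n} → ⊥ {m} ++ ⊥ {n} ≡ ⊥
⊥++⊥ zero    = refl
⊥++⊥ (suc m) = cong (false ∷_) (⊥++⊥ m)

∣++∣ : ∀ {m n} (p : Subset m) (q : Subset n) → ∣ p ++ q ∣ ≡ ∣ p ∣ + ∣ q ∣
∣++∣ []          q = refl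
∣++∣ (true ∷ p)  q = cong suc (∣++∣ p q)
∣++∣ (false ∷ p) q = ∣++∣ p q

++-∩ : ∀ {m n} (p p′ : Subset m) (q q′ : Subset n) → (p ++ q) ∩ (p′ ++ q′) ≡ (p ∩ p′) ++ (q ∩ q′)
++-∩ p p′ q q′ = zipWith-++ _∧_ p q p′ q′

subset-of-size : ∀ {t b} → t ≤ b → Σ[ w ∈ Subset b ] ∣ w ∣ ≡ t
subset-of-size {b = b} z≤n = ⊥ , ∣⊥∣≡0 b
subset-of-size (s≤s t≤b) with w , size ← subset-of-size t≤b = true ∷ w , cong suc size

-- Palette operations.  Each sends ∩ to ∩ and ∅ to ∅ and changes sizes in a
-- controlled way, so it turns colorings into colorings.

∣permute∣ : ∀ {N} (π : Permutation N N) p → ∣ permute π p ∣ ≡ ∣ p ∣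
∣permute∣ π p = begin
  ∣ permute π p ∣                    ≡⟨ ∣p∣≡count (permute π p) ⟩
  count (lookup (permute π p))       ≡⟨ sum-cong-≗ (cong bit ∘ lookup∘tabulate (lookup p ∘ (π ⟨$⟩ʳ_))) ⟩
  count (lookup p ∘ (π ⟨$⟩ʳ_))       ≡⟨ count-permute (lookup p) π ⟩
  count (lookup p)                   ≡⟨ ∣p∣≡count p ⟨
  ∣ p ∣                              ∎

permute-∩ : ∀ {N} (π : Permutation N N) p q → permute π (p ∩ q) ≡ permute π p ∩ permute π q
permute-∩ π p q = permute-onto π {p ∩ q} λ z → begin
  lookup (p ∩ q) (π ⟨$⟩ʳ z)                          ≡⟨ lookup-zipWith _∧_ _ p q ⟩
  lookup p (π ⟨$⟩ʳ z) ∧ lookup q (π ⟨$⟩ʳ z)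
    ≡⟨ cong₂ _∧_ (lookup∘tabulate _ z) (lookup∘tabulate _ z) ⟨
  lookup (permute π p) z ∧ lookup (permute π q) z
    ≡⟨ lookup-zipWith _∧_ z (permute π p) (permute π q) ⟨
  lookup (permute π p ∩ permute π q) z               ∎

permute-⊥ : ∀ {N} (π : Permutation N N) → permute π ⊥ ≡ ⊥
permute-⊥ π = permute-onto π {⊥} λ z →
  trans (lookup-replicate (π ⟨$⟩ʳ z) false) (sym (lookup-replicate z false))

blowUp : ∀ {m} d → Subset m → Subset (m * d)
blowUp d []      = []
blowUp d (β ∷ w) = replicate d β ++ blowUp d w

∣blowUp∣ : ∀ {m} d (w : Subset m) → ∣ blowUp d w ∣ ≡ ∣ w ∣ * d
∣blowUp∣ d []          = refl
∣blowUp∣ d (true ∷ w)  = trans (∣++∣ (replicate d true) _) (cong₂ _+_ (∣⊤∣≡n d) (∣blowUp∣ d w))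
∣blowUp∣ d (false ∷ w) = trans (∣++∣ (⊥ {d}) _) (cong₂ _+_ (∣⊥∣≡0 d) (∣blowUp∣ d w))

blowUp-∩ : ∀ {m} d (w w′ : Subset m) → blowUp d (w ∩ w′) ≡ blowUp d w ∩ blowUp d w′
blowUp-∩ d []      []        = refl
blowUp-∩ d (β ∷ w) (β′ ∷ w′) = sym (begin
  (replicate d β ++ blowUp d w) ∩ (replicate d β′ ++ blowUp d w′)
    ≡⟨ ++-∩ (replicate d β) (replicate d β′) (blowUp d w) (blowUp d w′) ⟩
  (replicate d β ∩ replicate d β′) ++ (blowUp d w ∩ blowUp d w′)
    ≡⟨ cong₂ _++_ (zipWith-replicate _∧_ β β′) (sym (blowUp-∩ d w w′)) ⟩
  replicate d (β ∧ β′) ++ blowUp d (w ∩ w′) ∎)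

blowUp-⊥ : ∀ m d → blowUp d (⊥ {m}) ≡ ⊥
blowUp-⊥ zero    d = refl
blowUp-⊥ (suc m) d = trans (cong (⊥ {d} ++_) (blowUp-⊥ m d)) (⊥++⊥ d)

∣blowUp∩blowUp∣ : ∀ {m} d (p q : Subset m) → ∣ blowUp d p ∩ blowUp d q ∣ ≡ ∣ p ∩ q ∣ * d
∣blowUp∩blowUp∣ d p q = trans (cong ∣_∣ (sym (blowUp-∩ d p q))) (∣blowUp∣ d (p ∩ q))

select : ∀ {m c} → Subset m → Subset c → Subset c → Subset (m * c)
select []      p q = []
select (β ∷ w) p q = (if β then p else q) ++ select w p q

∣select∣ : ∀ {m c} (w : Subset m) (p q : Subset c) →
           ∣ select w p q ∣ ≡ ∣ w ∣ * ∣ p ∣ + ∣ ∁ w ∣ * ∣ q ∣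
∣select∣ []          p q = refl
∣select∣ (true ∷ w)  p q = begin
  ∣ p ++ select w p q ∣                       ≡⟨ ∣++∣ p _ ⟩
  ∣ p ∣ + ∣ select w p q ∣                     ≡⟨ cong (∣ p ∣ +_) (∣select∣ w p q) ⟩
  ∣ p ∣ + (∣ w ∣ * ∣ p ∣ + ∣ ∁ w ∣ * ∣ q ∣)     ≡⟨ +-assoc ∣ p ∣ _ _ ⟨
  ∣ p ∣ + ∣ w ∣ * ∣ p ∣ + ∣ ∁ w ∣ * ∣ q ∣       ∎
∣select∣ (false ∷ w) p q = begin
  ∣ q ++ select w p q ∣                       ≡⟨ ∣++∣ q _ ⟩
  ∣ q ∣ + ∣ select w p q ∣                     ≡⟨ cong (∣ q ∣ +_) (∣select∣ w p q) ⟩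
  ∣ q ∣ + (∣ w ∣ * ∣ p ∣ + ∣ ∁ w ∣ * ∣ q ∣)     ≡⟨ x∙yz≈y∙xz ∣ q ∣ (∣ w ∣ * ∣ p ∣) (∣ ∁ w ∣ * ∣ q ∣) ⟩
  ∣ w ∣ * ∣ p ∣ + (∣ q ∣ + ∣ ∁ w ∣ * ∣ q ∣)     ∎

select-∩ : ∀ {m c} (w : Subset m) (p q p′ q′ : Subset c) →
           select w p q ∩ select w p′ q′ ≡ select w (p ∩ p′) (q ∩ q′)
select-∩ []          p q p′ q′ = refl
select-∩ (true ∷ w)  p q p′ q′ = trans (++-∩ p p′ _ _) (cong ((p ∩ p′) ++_) (select-∩ w p q p′ q′))
select-∩ (false ∷ w) p q p′ q′ = trans (++-∩ q q′ _ _) (cong ((q ∩ q′) ++_) (select-∩ w p q p′ q′))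

select-⊥ : ∀ {m c} (w : Subset m) → select w (⊥ {c}) ⊥ ≡ ⊥
select-⊥             []          = refl
select-⊥ {c = c} (true ∷ w)  = trans (cong (⊥ ++_) (select-⊥ w)) (⊥++⊥ c)
select-⊥ {c = c} (false ∷ w) = trans (cong (⊥ ++_) (select-⊥ w)) (⊥++⊥ c)

pad : ∀ {m} e → Subset m → Subset (m + e)
pad e p = p ++ ⊥

∣pad∣ : ∀ {m} e (p : Subset m) → ∣ pad e p ∣ ≡ ∣ p ∣
∣pad∣ e p = trans (∣++∣ p ⊥) (trans (cong (∣ p ∣ +_) (∣⊥∣≡0 e)) (+-identityʳ _))

pad-∩ : ∀ {m} e (p q : Subset m) → pad e (p ∩ q) ≡ pad e p ∩ pad e q
pad-∩ e p q = sym (trans (++-∩ p q ⊥ ⊥) (cong ((p ∩ q) ++_) (zipWith-replicate _∧_ false false)))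

-- Colorings of a graph on the points satisfying P, with adjacency R, given
-- as a function on all of Fin n (values outside P are irrelevant).  Working
-- with total functions lets colorings of different subgraphs be compared
-- and combined pointwise.
record IsColoring {n} (a b : ℕ) (P : Fin n → Set) (R : Fin n → Fin n → Set)
                  (f : Fin n → Subset a) : Set where
  field
    size   : ∀ {x} → P x → ∣ f x ∣ ≡ b
    proper : ∀ {x y} → P x → P y → R x y → Empty (f x ∩ f y)
open IsColoring

module _ {n : ℕ} {P : Fin n → Set} {R : Fin n → Fin n → Set} where

  recolor : ∀ {a a′ b b′} {f : Fin n → Subset a} (F : Subset a → Subset a′) →
            (∀ p q → F (p ∩ q) ≡ F p ∩ F q) → F ⊥ ≡ ⊥ → (∀ {p} → ∣ p ∣ ≡ b → ∣ F p ∣ ≡ b′) →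
            IsColoring a b P R f → IsColoring a′ b′ P R (F ∘ f)
  recolor {f = f} F F-∩ F-⊥ F-size col = record
    { size   = F-size ∘ size col
    ; proper = λ {x} {y} px py r → ⊥-Empty (begin
        F (f x) ∩ F (f y)   ≡⟨ F-∩ (f x) (f y) ⟨
        F (f x ∩ f y)       ≡⟨ cong F (Empty-unique (proper col px py r)) ⟩
        F ⊥                 ≡⟨ F-⊥ ⟩
        ⊥                   ∎) }

  blowUp-coloring : ∀ {a b d} {f : Fin n → Subset a} →
                    IsColoring a b P R f → IsColoring (a * d) (b * d) P R (blowUp d ∘ f)
  blowUp-coloring {a} {d = d} = recolor (blowUp d) (blowUp-∩ d) (blowUp-⊥ a d)
                                        (λ {p} size-p → trans (∣blowUp∣ d p) (cong (_* d) size-p))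

  mix : ∀ {m c d} {f g : Fin n → Subset c} (w : Subset m) →
        IsColoring c d P R f → IsColoring c d P R g →
        IsColoring (m * c) (m * d) P R (λ x → select w (f x) (g x))
  mix {m} {c} {d} {f} {g} w col-f col-g = record
    { size   = λ {x} px → begin
        ∣ select w (f x) (g x) ∣                  ≡⟨ ∣select∣ w (f x) (g x) ⟩
        ∣ w ∣ * ∣ f x ∣ + ∣ ∁ w ∣ * ∣ g x ∣
          ≡⟨ cong₂ (λ s t → ∣ w ∣ * s + ∣ ∁ w ∣ * t) (size col-f px) (size col-g px) ⟩
        ∣ w ∣ * d + ∣ ∁ w ∣ * d                    ≡⟨ *-distribʳ-+ d ∣ w ∣ ∣ ∁ w ∣ ⟨
        (∣ w ∣ + ∣ ∁ w ∣) * d                      ≡⟨ cong (_* d) ∣w∣+∣∁w∣≡m ⟩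
        m * d                                      ∎
    ; proper = λ {x} {y} px py r → ⊥-Empty (begin
        select w (f x) (g x) ∩ select w (f y) (g y)  ≡⟨ select-∩ w (f x) (g x) (f y) (g y) ⟩
        select w (f x ∩ f y) (g x ∩ g y)
          ≡⟨ cong₂ (select w) (Empty-unique (proper col-f px py r)) (Empty-unique (proper col-g px py r)) ⟩
        select w ⊥ ⊥                                 ≡⟨ select-⊥ w ⟩
        ⊥                                            ∎) }
    where
    ∣w∣+∣∁w∣≡m : ∣ w ∣ + ∣ ∁ w ∣ ≡ m
    ∣w∣+∣∁w∣≡m = trans (cong (∣ w ∣ +_) (∣∁p∣≡n∸∣p∣ w)) (m+[n∸m]≡n (∣p∣≤n w))

  widen : ∀ {m N b} {f : Fin n → Subset m} → m ≤ N → IsColoring m b P R f →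
          Σ[ g ∈ (Fin n → Subset N) ] (IsColoring N b P R g × ∀ x y → ∣ g x ∩ g y ∣ ≡ ∣ f x ∩ f y ∣)
  widen {m} {N} {b} {f} m≤N col =
    subst (λ M → Σ[ g ∈ (Fin n → Subset M) ] (IsColoring M b P R g × ∀ x y → ∣ g x ∩ g y ∣ ≡ ∣ f x ∩ f y ∣))
          (m+[n∸m]≡n m≤N)
          (pad e ∘ f , recolor (pad e) (pad-∩ e) (⊥++⊥ m) (λ {p} → trans (∣pad∣ e p)) col , intersections)
    where
    e : ℕ
    e = N ∸ m

    intersections : ∀ x y → ∣ pad e (f x) ∩ pad e (f y) ∣ ≡ ∣ f x ∩ f y ∣
    intersections x y = trans (cong ∣_∣ (sym (pad-∩ e (f x) (f y)))) (∣pad∣ e (f x ∩ f y))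

pullback : ∀ {n a b} {P Q : Fin n → Set} {R R′ : Fin n → Fin n → Set} {f : Fin n → Subset a}
           (h : Fin n → Fin n) → (∀ {x} → Q x → P (h x)) →
           (∀ {x y} → Q x → Q y → R′ x y → R (h x) (h y)) →
           IsColoring a b P R f → IsColoring a b Q R′ (f ∘ h)
pullback h vertex edge col = record
  { size   = size col ∘ vertex
  ; proper = λ qx qy r → proper col (vertex qx) (vertex qy) (edge qx qy r) }

-- The graphs of the statement (induced subgraphs, G+uv and G/uv) all live on
-- a subset of Fin n with an adjacency depending only on the underlying points.
SubGraph : ∀ {n} → (Fin n → Set) → (Fin n → Fin n → Set) → Graph
SubGraph {n} P R = record { V = Σ (Fin n) P ; Adj = λ x y → R (proj₁ x) (proj₁ y) }

extend : ∀ {n a b} {P : Fin n → Set} {R : Fin n → Fin n → Set} → Decidable P →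
         HasColoring a b (SubGraph P R) → Σ[ f ∈ (Fin n → Subset a) ] IsColoring a b P R f
extend {n} {a} {b} {P} {R} P? (φ , φ-size , φ-proper) = f , record { size = size′ ; proper = proper′ }
  where
  f : Fin n → Subset a
  f x with P? x
  ... | yes px = φ (x , px)
  ... | no _   = ⊥

  value : ∀ {x} → P x → Σ[ px ∈ P x ] f x ≡ φ (x , px)
  value {x} px with P? x
  ... | yes px′ = px′ , refl
  ... | no ¬px  = ⊥-elim (¬px px)

  size′ : ∀ {x} → P x → ∣ f x ∣ ≡ b
  size′ px with px′ , fx≡ ← value px = trans (cong ∣_∣ fx≡) (φ-size (_ , px′))

  proper′ : ∀ {x y} → P x → P y → R x y → Empty (f x ∩ f y)
  proper′ px py r with px′ , fx≡ ← value px | py′ , fy≡ ← value py =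
    subst Empty (sym (cong₂ _∩_ fx≡ fy≡)) (φ-proper (_ , px′) (_ , py′) r)

plusEdge-coloring : ∀ {n c d} (G : SimpleGraph n) {S : Subset n} {U W : Fin n} → U ∈ S → W ∈ S →
  HasColoring c d (plusEdge G S U W) →
  Σ[ f ∈ (Fin n → Subset c) ] (IsColoring c d (_∈ S) (adj G) f × Empty (f U ∩ f W))
plusEdge-coloring {n} {c} {d} G {S} {U} {W} U∈S W∈S χ =
  f , pullback id id (λ _ _ → inj₁) col , proper col U∈S W∈S (inj₂ (inj₁ (refl , refl)))
  where
  R : Fin n → Fin n → Set
  R x y = adj G x y ⊎ ((x ≡ U × y ≡ W) ⊎ (x ≡ W × y ≡ U))

  extended : Σ[ f ∈ (Fin n → Subset c) ] IsColoring c d (_∈ S) R f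
  extended = extend (_∈? S) χ

  f : Fin n → Subset c
  f = proj₁ extended

  col : IsColoring c d (_∈ S) R f
  col = proj₂ extended

-- A coloring of G[S] / UW, read through the map merging W into U, is a
-- coloring of G[S] giving U and W the same set.
contract-coloring : ∀ {n c d} (G : SimpleGraph n) {S : Subset n} {U W : Fin n} →
  U ∈ S → U ≢ W → ¬ adj G U W → HasColoring c d (contract G S U W) →
  Σ[ f ∈ (Fin n → Subset c) ] (IsColoring c d (_∈ S) (adj G) f × f W ≡ f U)
contract-coloring {n} {c} {d} G {S} {U} {W} U∈S U≢W ¬UW χ =
  g ∘ merge , pullback merge vertex edge col , cong g (trans merge-W (sym merge-U))
  where
  P : Fin n → Set
  P x = x ∈ S × x ≢ W

  R : Fin n → Fin n → Set
  R x y = x ≢ y × (adj G x y ⊎ ((x ≡ U × adj G W y) ⊎ (y ≡ U × adj G x W)))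

  extended : Σ[ g ∈ (Fin n → Subset c) ] IsColoring c d P R g
  extended = extend (λ x → (x ∈? S) ×-dec ¬? (x ≟ W)) χ

  g : Fin n → Subset c
  g = proj₁ extended

  col : IsColoring c d P R g
  col = proj₂ extended

  merge : Fin n → Fin n
  merge x with x ≟ W
  ... | yes _ = U
  ... | no _  = x

  merge-W : merge W ≡ U
  merge-W with W ≟ W
  ... | yes _  = refl
  ... | no W≢W = ⊥-elim (W≢W refl)

  merge-U : merge U ≡ U
  merge-U with U ≟ W
  ... | yes U≡W = ⊥-elim (U≢W U≡W)
  ... | no _    = refl

  vertex : ∀ {x} → x ∈ S → P (merge x)
  vertex {x} x∈S with x ≟ W
  ... | yes _   = U∈S , U≢W
  ... | no x≢W = x∈S , x≢W

  -- edges of G[S] map to edges of the contraction; U and W are not adjacent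
  edge : ∀ {x y} → x ∈ S → y ∈ S → adj G x y → R (merge x) (merge y)
  edge {x} {y} _ _ xy with x ≟ W | y ≟ W
  ... | yes refl | yes refl = ⊥-elim (irrfl G xy)
  ... | yes refl | no _     = (λ { refl → ¬UW (SimpleGraph.sym G xy) }) , inj₂ (inj₁ (refl , xy))
  ... | no _     | yes refl = (λ { refl → ¬UW xy }) , inj₂ (inj₂ (refl , xy))
  ... | no _     | no _     = (λ { refl → irrfl G xy }) , inj₁ xy

module _ {n : ℕ} {U W : Fin n} where

  ∈-pairˡ : U ∈ ⁅ U ⁆ ∪ ⁅ W ⁆
  ∈-pairˡ = x∈p∪q⁺ (inj₁ (x∈⁅x⁆ U))

  ∈-pairʳ : W ∈ ⁅ U ⁆ ∪ ⁅ W ⁆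
  ∈-pairʳ = x∈p∪q⁺ (inj₂ (x∈⁅x⁆ W))

  ∈-pair⁻ : ∀ {x} → x ∈ ⁅ U ⁆ ∪ ⁅ W ⁆ → x ≡ U ⊎ x ≡ W
  ∈-pair⁻ x∈ with x∈p∪q⁻ ⁅ U ⁆ ⁅ W ⁆ x∈
  ... | inj₁ x∈U = inj₁ (x∈⁅y⁆⇒x≡y U x∈U)
  ... | inj₂ x∈W = inj₂ (x∈⁅y⁆⇒x≡y W x∈W)

  pair-distinct : ∣ ⁅ U ⁆ ∪ ⁅ W ⁆ ∣ ≡ 2 → U ≢ W
  pair-distinct two refl with () ← trans (sym two) (trans (cong ∣_∣ (∪-idem ⁅ U ⁆)) (∣⁅x⁆∣≡1 U))

agree-on-pair : ∀ {A B : Set} (g h : A → B) {U W x} →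
                g U ≡ h U → g W ≡ h W → x ≡ U ⊎ x ≡ W → g x ≡ h x
agree-on-pair g h gU gW (inj₁ refl) = gU
agree-on-pair g h gU gW (inj₂ refl) = gW

glue : ∀ {n k m b} (G : SimpleGraph n) (V₀ : Subset n) (Vs : Fin k → Subset n) →
  (∀ x → x ∈ V₀ ⊎ Σ (Fin k) (λ i → x ∈ Vs i)) →
  (∀ x y → adj G x y → (x ∈ V₀ × y ∈ V₀) ⊎ Σ (Fin k) (λ i → x ∈ Vs i × y ∈ Vs i)) →
  (∀ i j → i ≢ j → (Vs i ∩ Vs j) ⊆ V₀) →
  (f₀ : Fin n → Subset m) → IsColoring m b (_∈ V₀) (adj G) f₀ →
  (fs : Fin k → Fin n → Subset m) → (∀ i → IsColoring m b (_∈ Vs i) (adj G) (fs i)) →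
  (∀ i {x} → x ∈ V₀ → x ∈ Vs i → fs i x ≡ f₀ x) →
  HasColoring m b (whole G)
glue {n} {k} {m} {b} G V₀ Vs cover edges disj f₀ col₀ fs cols agree =
  F , (λ x → size-pick (cover x)) , proper′
  where
  Home : Fin n → Set
  Home x = x ∈ V₀ ⊎ Σ (Fin k) (λ i → x ∈ Vs i)

  pick : ∀ {x} → Home x → Subset m
  pick {x} (inj₁ _)       = f₀ x
  pick {x} (inj₂ (i , _)) = fs i x

  F : Fin n → Subset m
  F x = pick (cover x)

  pick-V₀ : ∀ {x} (h : Home x) → x ∈ V₀ → pick h ≡ f₀ x
  pick-V₀ (inj₁ _)           _    = refl
  pick-V₀ (inj₂ (i , x∈Vi)) x∈V₀ = agree i x∈V₀ x∈Vi

  pick-Vs : ∀ {x} (h : Home x) i → x ∈ Vs i → pick h ≡ fs i x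
  pick-Vs (inj₁ x∈V₀)        i x∈Vi = sym (agree i x∈V₀ x∈Vi)
  pick-Vs (inj₂ (j , x∈Vj)) i x∈Vi with j ≟ i
  ... | yes refl = refl
  ... | no j≢i   = trans (agree j x∈V₀ x∈Vj) (sym (agree i x∈V₀ x∈Vi))
    where x∈V₀ = disj j i j≢i (x∈p∩q⁺ (x∈Vj , x∈Vi))

  size-pick : ∀ {x} (h : Home x) → ∣ pick h ∣ ≡ b
  size-pick (inj₁ x∈V₀)       = size col₀ x∈V₀
  size-pick (inj₂ (i , x∈Vi)) = size (cols i) x∈Vi

  proper′ : ∀ x y → adj G x y → Empty (F x ∩ F y)
  proper′ x y xy with edges x y xy
  ... | inj₁ (x∈V₀ , y∈V₀) =
    subst Empty (sym (cong₂ _∩_ (pick-V₀ (cover x) x∈V₀) (pick-V₀ (cover y) y∈V₀)))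
          (proper col₀ x∈V₀ y∈V₀ xy)
  ... | inj₂ (i , x∈Vi , y∈Vi) =
    subst Empty (sym (cong₂ _∩_ (pick-Vs (cover x) i x∈Vi) (pick-Vs (cover y) i y∈Vi)))
          (proper (cols i) x∈Vi y∈Vi xy)

part-coloring : ∀ {n c d b t N} (G : SimpleGraph n) {S : Subset n} {U W : Fin n} →
  U ∈ S → W ∈ S → U ≢ W → ¬ adj G U W →
  HasColoring c d (plusEdge G S U W) → HasColoring c d (contract G S U W) →
  b * c ≤ N → t ≤ b → (p q : Subset N) → ∣ p ∣ ≡ b * d → ∣ q ∣ ≡ b * d → ∣ p ∩ q ∣ ≡ t * d →
  Σ[ g ∈ (Fin n → Subset N) ] (IsColoring N (b * d) (_∈ S) (adj G) g × g U ≡ p × g W ≡ q)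
part-coloring {n} {c} {d} {b} {t} {N} G {S} {U} {W} U∈S W∈S U≢W ¬UW χ₊ χ/ bc≤N t≤b p q ∣p∣ ∣q∣ ∣p∩q∣ =
  permute π ∘ h , recolor (permute π) (permute-∩ π) (permute-⊥ π) (λ {r} → trans (∣permute∣ π r)) col-h ,
  proj₁ (proj₂ matched) , proj₂ (proj₂ matched)
  where
  separating : Σ[ f ∈ (Fin n → Subset c) ] (IsColoring c d (_∈ S) (adj G) f × Empty (f U ∩ f W))
  separating = plusEdge-coloring G U∈S W∈S χ₊

  f₊ : Fin n → Subset c
  f₊ = proj₁ separating

  identifying : Σ[ f ∈ (Fin n → Subset c) ] (IsColoring c d (_∈ S) (adj G) f × f W ≡ f U)
  identifying = contract-coloring G U∈S U≢W ¬UW χ/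

  f/ : Fin n → Subset c
  f/ = proj₁ identifying

  -- the t blocks colored by the contraction
  w : Subset b
  w = proj₁ (subset-of-size t≤b)

  mixed : IsColoring (b * c) (b * d) (_∈ S) (adj G) (λ x → select w (f/ x) (f₊ x))
  mixed = mix w (proj₁ (proj₂ identifying)) (proj₁ (proj₂ separating))

  -- only the t contraction blocks contribute to the overlap of the terminals
  overlap-mixed : ∣ select w (f/ U) (f₊ U) ∩ select w (f/ W) (f₊ W) ∣ ≡ t * d
  overlap-mixed = begin
    ∣ select w (f/ U) (f₊ U) ∩ select w (f/ W) (f₊ W) ∣
      ≡⟨ cong ∣_∣ (select-∩ w (f/ U) (f₊ U) (f/ W) (f₊ W)) ⟩
    ∣ select w (f/ U ∩ f/ W) (f₊ U ∩ f₊ W) ∣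
      ≡⟨ cong₂ (λ r s → ∣ select w r s ∣)
               (trans (cong (f/ U ∩_) (proj₂ (proj₂ identifying))) (∩-idem (f/ U)))
               (Empty-unique (proj₂ (proj₂ separating))) ⟩
    ∣ select w (f/ U) ⊥ ∣
      ≡⟨ ∣select∣ w (f/ U) ⊥ ⟩
    ∣ w ∣ * ∣ f/ U ∣ + ∣ ∁ w ∣ * ∣ ⊥ {c} ∣
      ≡⟨ cong₂ (λ r s → r * ∣ f/ U ∣ + ∣ ∁ w ∣ * s) (proj₂ (subset-of-size t≤b)) (∣⊥∣≡0 c) ⟩
    t * ∣ f/ U ∣ + ∣ ∁ w ∣ * 0
      ≡⟨ cong₂ (λ r s → t * r + s) (size (proj₁ (proj₂ identifying)) U∈S) (*-zeroʳ ∣ ∁ w ∣) ⟩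
    t * d + 0
      ≡⟨ +-identityʳ (t * d) ⟩
    t * d ∎

  widened : Σ[ g ∈ (Fin n → Subset N) ]
              (IsColoring N (b * d) (_∈ S) (adj G) g ×
               ∀ x y → ∣ g x ∩ g y ∣ ≡ ∣ select w (f/ x) (f₊ x) ∩ select w (f/ y) (f₊ y) ∣)
  widened = widen bc≤N mixed

  h : Fin n → Subset N
  h = proj₁ widened

  col-h : IsColoring N (b * d) (_∈ S) (adj G) h
  col-h = proj₁ (proj₂ widened)

  matched : Σ[ π ∈ Permutation N N ] (permute π (h U) ≡ p × permute π (h W) ≡ q)
  matched = match (h U) (h W) p q (trans (size col-h U∈S) (sym ∣p∣)) (trans (size col-h W∈S) (sym ∣q∣))
                  (trans (proj₂ (proj₂ widened) U W) (trans overlap-mixed (sym ∣p∩q∣)))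

  π : Permutation N N
  π = proj₁ matched

lemma29 : (n k : ℕ) → 1 ≤ k → (G : SimpleGraph n) →
    (V₀ : Subset n) → (Vs : Fin k → Subset n) →
    (∀ x → x ∈ V₀ ⊎ Σ (Fin k) (λ i → x ∈ Vs i)) →
    (∀ x y → adj G x y →
      (x ∈ V₀ × y ∈ V₀) ⊎ Σ (Fin k) (λ i → x ∈ Vs i × y ∈ Vs i)) →
    (∀ i → ∣ V₀ ∩ Vs i ∣ ≡ 2) →
    (∀ i j → i ≢ j → (Vs i ∩ Vs j) ⊆ V₀) →
    (u v : Fin k → Fin n) →
    (∀ i → V₀ ∩ Vs i ≡ ⁅ u i ⁆ ∪ ⁅ v i ⁆) →
    (∀ i → ¬ adj G (u i) (v i)) →
    (a b c d : ℕ) → 1 ≤ a → 1 ≤ b → 1 ≤ c → 1 ≤ d →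
    c * b ≤ a * d →
    HasColoring a b (induced G V₀) →
    (∀ i → HasColoring c d (plusEdge G (Vs i) (u i) (v i))
         × HasColoring c d (contract G (Vs i) (u i) (v i))) →
    HasColoring (a * d) (b * d) (whole G)
lemma29 n k _ G V₀ Vs cover edges card2 disj u v terminals nonadj a b c d _ _ _ _ cb≤ad χ₀ χs =
  glue G V₀ Vs cover edges disj (blowUp d ∘ f₀) col₀ (proj₁ ∘ part) (proj₁ ∘ proj₂ ∘ part) agree
  where
  base : Σ[ f ∈ (Fin n → Subset a) ] IsColoring a b (_∈ V₀) (adj G) f
  base = extend (_∈? V₀) χ₀

  f₀ : Fin n → Subset a
  f₀ = proj₁ base

  col₀ : IsColoring (a * d) (b * d) (_∈ V₀) (adj G) (blowUp d ∘ f₀)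
  col₀ = blowUp-coloring (proj₂ base)

  terminal : ∀ i x → x ∈ ⁅ u i ⁆ ∪ ⁅ v i ⁆ → x ∈ V₀ × x ∈ Vs i
  terminal i x x∈ = x∈p∩q⁻ V₀ (Vs i) (subst (x ∈_) (sym (terminals i)) x∈)

  u∈ : ∀ i → u i ∈ V₀ × u i ∈ Vs i
  u∈ i = terminal i (u i) ∈-pairˡ

  v∈ : ∀ i → v i ∈ V₀ × v i ∈ Vs i
  v∈ i = terminal i (v i) ∈-pairʳ

  u≢v : ∀ i → u i ≢ v i
  u≢v i = pair-distinct (trans (cong ∣_∣ (sym (terminals i))) (card2 i))

  t≤b : ∀ i → ∣ f₀ (u i) ∩ f₀ (v i) ∣ ≤ b
  t≤b i = ≤-trans (∣p∩q∣≤∣p∣ (f₀ (u i)) (f₀ (v i))) (≤-reflexive (size (proj₂ base) (proj₁ (u∈ i))))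

  part : ∀ i → Σ[ g ∈ (Fin n → Subset (a * d)) ]
                 (IsColoring (a * d) (b * d) (_∈ Vs i) (adj G) g ×
                  g (u i) ≡ blowUp d (f₀ (u i)) × g (v i) ≡ blowUp d (f₀ (v i)))
  part i = part-coloring G (proj₂ (u∈ i)) (proj₂ (v∈ i)) (u≢v i) (nonadj i) (proj₁ (χs i)) (proj₂ (χs i))
    (subst (_≤ a * d) (*-comm c b) cb≤ad) (t≤b i) (blowUp d (f₀ (u i))) (blowUp d (f₀ (v i)))
    (size col₀ (proj₁ (u∈ i))) (size col₀ (proj₁ (v∈ i))) (∣blowUp∩blowUp∣ d (f₀ (u i)) (f₀ (v i)))

  agree : ∀ i {x} → x ∈ V₀ → x ∈ Vs i → proj₁ (part i) x ≡ blowUp d (f₀ x)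
  agree i {x} x∈V₀ x∈Vi =
    agree-on-pair (proj₁ (part i)) (blowUp d ∘ f₀) (proj₁ (proj₂ (proj₂ (part i))))
                  (proj₂ (proj₂ (proj₂ (part i))))
                  (∈-pair⁻ (subst (x ∈_) (terminals i) (x∈p∩q⁺ (x∈V₀ , x∈Vi))))
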